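{- Every Dupré-Tiplerian plausible value, regarded as a partial function from $\mathcal{T}\times\mathcal{E}(\mathcal{T})$ to $\overline{\mathbb{R}}$, is coherent.
   Context: Random quantities: $\mathcal{T}$ is a unital associative commutative algebra over $\mathbb{R}$; reals $r$ are identified with $r\mathbf{1}$; products are written $X.Y$. Events: idempotents $A$ ($A.A=A$). $\mathcal{E}(\mathcal{T})$ is the set of events and $\mathcal{E}_0(\mathcal{T})$ the set of nonzero events. Disjunction is $A\vee B=A+B-A.B$. $\overline{\mathbb{R}}=\mathbb{R}\cup\{\pm\infty\}$. Dupré-Tiplerian plausible value: a partial function $PV$ from $\mathcal{T}\times\mathcal{C}$ to $\mathbb{R}$, where $\mathcal{C}\subseteq\mathcal{E}_0(\mathcal{T})$ is closed under disjunction, such that - for every event $A$ and $C\in\mathcal{C}$, $PV(A|C)$ exists and $PV(A|C)\ge0$; - $PV(C|C)>0$ for $C\in\mathcal{C}$; - if $r\in\mathbb{R}$, $C\in\mathcal{C}$ and $PV(X|C)$ exists, then $PV(rX|C)=r\,PV(X|C)$; - if $C\in\mathcal{C}$ and both $PV(X|C)$ and $PV(Y|C)$ exist, then $PV(X+Y|C)=PV(X|C)+PV(Y|C)$; - if $C.D\in\mathcal{C}$, $D\in\mathcal{C}$ and $PV(X|C.D)$ exists, then $PV(X.C|D)=PV(X|C.D)\,PV(C|D)$. Coherence: a partial function $PV$ from $\mathcal{T}\times\mathcal{E}(\mathcal{T})$ to $\overline{\mathbb{R}}$ is coherent if the following holds. Whenever - $n\ge0$ and $m\ge1$ are integers, -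 $q_1,\dots,q_n$ are nonnegative reals, - $r_1,\dots,r_m,s_1,\dots,s_m$ are reals, - $C_1,\dots,C_n,D_1,\dots,D_m$ are events, - $X_1,\dots,X_m$ are random quantities, - and $r_j(PV(X_j|D_j)+s_j)>0$ for every $j$ (in particular each $PV(X_j|D_j)$ is defined), then $\sum_{i=1}^n q_iC_i+\sum_{j=1}^m r_j(X_j+s_j).D_j\neq0$. -}

module Defs where

open import Level using (0ℓ)
open import Data.Nat using (ℕ; zero; suc)
open import Data.Fin using (Fin; zero; suc)
open import Data.Product using (Σ; _×_; _,_)
open import Data.Sum using (_⊎_)
open import Data.Maybe using (Maybe; just; nothing; map)
open import Relation.Binary.PropositionalEquality using (_≡_; _≢_)
open import Relation.Binary.Definitions using (Trichotomous)
open import Relation.Nullary using (¬_)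

-- The real numbers, given axiomatically as a complete ordered field.
-- (Any two complete ordered fields are isomorphic, so quantifying over
-- all of them is the same as speaking about ℝ.)

record RealField : Set₁ where
  infixl 6 _+_
  infixl 7 _*_
  infix 4 _<_ _≤_
  field
    R    : Set
    0r 1r : R
    _+_ _*_ : R → R → R
    -_   : R → R
    _<_  : R → R → Set
    +-assoc : ∀ x y z → (x + y) + z ≡ x + (y + z)
    +-comm  : ∀ x y → x + y ≡ y + x
    +-idʳ   : ∀ x → x + 0r ≡ x
    +-invʳ  : ∀ x → x + (- x) ≡ 0r
    *-assoc : ∀ x y z → (x * y) * z ≡ x * (y * z)
    *-comm  : ∀ x y → x * y ≡ y * x
    *-idʳ   : ∀ x → x * 1r ≡ x
    distribʳ : ∀ x y z → (y + z) * x ≡ y * x + z * x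
    0≢1     : 0r ≢ 1r
    *-inv   : ∀ x → x ≢ 0r → Σ R (λ y → x * y ≡ 1r)
    <-irrefl : ∀ x → ¬ (x < x)
    <-trans  : ∀ {x y z} → x < y → y < z → x < z
    <-tri    : Trichotomous _≡_ _<_
    +-mono-< : ∀ {x y} z → x < y → x + z < y + z
    *-pos    : ∀ {x y} → 0r < x → 0r < y → 0r < x * y

  _≤_ : R → R → Set
  x ≤ y = (x < y) ⊎ (x ≡ y)

  IsUpperBound : (R → Set) → R → Set
  IsUpperBound P b = ∀ x → P x → x ≤ b

  field
    complete : (P : R → Set) → Σ R P → Σ R (IsUpperBound P) →
               Σ R (λ s → IsUpperBound P s × (∀ b → IsUpperBound P b → s ≤ b))

module _ (F : RealField) where
  open RealField F

  data ExtR : Set where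
    fin  : R → ExtR
    +∞ -∞ : ExtR

  -- the condition  r (v + s) > 0  for v an extended real
  -- (conventions: +∞ + s = +∞, r·(+∞) = +∞ if r>0, -∞ if r<0, 0 if r=0; dually for -∞)
  PosTerm : R → ExtR → R → Set
  PosTerm r (fin v) s = 0r < r * (v + s)
  PosTerm r +∞ s = 0r < r
  PosTerm r -∞ s = r < 0r

record RAlgebra (F : RealField) : Set₁ where
  open RealField F using (R; 0r; 1r) renaming (_+_ to _+ᵣ_; _*_ to _*ᵣ_)
  infixl 6 _⊕_
  infixl 7 _⊙_
  infixr 8 _·_
  field
    T    : Set
    𝟘 𝟙  : T
    _⊕_ _⊙_ : T → T → T
    ⊖_   : T → T
    _·_  : R → T → T
    ⊕-assoc : ∀ x y z → (x ⊕ y) ⊕ z ≡ x ⊕ (y ⊕ z)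
    ⊕-comm  : ∀ x y → x ⊕ y ≡ y ⊕ x
    ⊕-idʳ   : ∀ x → x ⊕ 𝟘 ≡ x
    ⊕-invʳ  : ∀ x → x ⊕ (⊖ x) ≡ 𝟘
    ⊙-assoc : ∀ x y z → (x ⊙ y) ⊙ z ≡ x ⊙ (y ⊙ z)
    ⊙-comm  : ∀ x y → x ⊙ y ≡ y ⊙ x
    ⊙-idʳ   : ∀ x → x ⊙ 𝟙 ≡ x
    distribʳ : ∀ x y z → (y ⊕ z) ⊙ x ≡ y ⊙ x ⊕ z ⊙ x
    ·-distribˡ : ∀ r x y → r · (x ⊕ y) ≡ r · x ⊕ r · y
    ·-distribʳ : ∀ r s x → (r +ᵣ s) · x ≡ r · x ⊕ s · x
    ·-assoc    : ∀ r s x → (r *ᵣ s) · x ≡ r · (s · x)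
    ·-id       : ∀ x → 1r · x ≡ x
    ·-⊙        : ∀ r x y → r · (x ⊙ y) ≡ (r · x) ⊙ y

  ι : R → T
  ι r = r · 𝟙

  IsEvent : T → Set
  IsEvent A = A ⊙ A ≡ A

  IsNonzeroEvent : T → Set
  IsNonzeroEvent A = IsEvent A × (A ≢ 𝟘)

  _∨_ : T → T → T
  A ∨ B = A ⊕ B ⊕ (⊖ (A ⊙ B))

  ∑ : (n : ℕ) → (Fin n → T) → T
  ∑ zero    f = 𝟘
  ∑ (suc n) f = f zero ⊕ ∑ n (λ i → f (suc i))

module _ {F : RealField} (A : RAlgebra F) where
  open RealField F
  open RAlgebra A

  -- PV : partial function T × 𝒞 → ℝ, encoded as T → T → Maybe R;
  -- PV X C is meaningful only for C ∈ 𝒞 (enforced by `dom⊆𝒞`).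
  record IsDTPlausibleValue (𝒞 : T → Set) (PV : T → T → Maybe R) : Set where
    field
      dom⊆𝒞   : ∀ X C v → PV X C ≡ just v → 𝒞 C
      𝒞⊆E₀    : ∀ C → 𝒞 C → IsNonzeroEvent C
      𝒞-∨     : ∀ C D → 𝒞 C → 𝒞 D → 𝒞 (C ∨ D)
      pv-event : ∀ A C → IsEvent A → 𝒞 C → Σ R (λ v → (PV A C ≡ just v) × (0r ≤ v))
      pv-self  : ∀ C → 𝒞 C → Σ R (λ v → (PV C C ≡ just v) × (0r < v))
      pv-scale : ∀ r X C v → 𝒞 C → PV X C ≡ just v → PV (r · X) C ≡ just (r * v)
      pv-add   : ∀ X Y C v w → 𝒞 C → PV X C ≡ just v → PV Y C ≡ just w →
                 PV (X ⊕ Y) C ≡ just (v + w)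
      pv-mult  : ∀ X C D v → 𝒞 (C ⊙ D) → 𝒞 D → PV X (C ⊙ D) ≡ just v →
                 Σ R (λ w → (PV C D ≡ just w) × (PV (X ⊙ C) D ≡ just (v * w)))

  Coherent : (T → T → Maybe (ExtR F)) → Set
  Coherent P =
    ∀ (n m' : ℕ) →
    let m = suc m' in
    (q : Fin n → R) → (∀ i → 0r ≤ q i) →
    (r s : Fin m → R) →
    (Cs : Fin n → T) → (∀ i → IsEvent (Cs i)) →
    (Ds : Fin m → T) → (∀ j → IsEvent (Ds j)) →
    (Xs : Fin m → T) →
    (∀ j → Σ (ExtR F) (λ v → (P (Xs j) (Ds j) ≡ just v) × PosTerm F (r j) v (s j))) →
    (∑ n (λ i → q i · Cs i) ⊕ ∑ m (λ j → (r j · (Xs j ⊕ ι (s j))) ⊙ Ds j)) ≢ 𝟘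

  asExtended : (T → T → Maybe R) → T → T → Maybe (ExtR F)
  asExtended PV X D = map (fin {F}) (PV X D)

-- Let D be the disjunction of the conditioning events D_j: it lies in 𝒞 and every D_j ⊑ D.
-- Conditioned on D, the multiplication axiom turns the plausible value of the combination into
-- Σ q_i PV(C_i|D) + Σ r_j (PV(X_j|D_j) + s_j) PV(D_j|D), a sum of nonnegative terms. If the
-- combination were 0, every PV(D_j|D) would vanish, hence so would PV(D|D) by inclusion–exclusion,
-- contradicting PV(D|D) > 0.
module Submission where

open import Defs
open import Level using (0ℓ)
open import Algebra.Core using (Op₁; Op₂)
open import Algebra.Bundles using (CommutativeRing)
open import Algebra.Structures using (IsCommutativeRing)
import Algebra.Definitions
import Algebra.Consequences.Propositional
import Algebra.Properties.Group
import Algebra.Properties.Ring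
import Algebra.Properties.Monoid.Sum
open import Data.Maybe using (Maybe; just)
open import Data.Maybe.Properties using (just-injective)
open import Data.Nat using (ℕ; zero; suc)
open import Data.Fin using (Fin; zero; suc)
open import Data.Product using (Σ; _×_; _,_; proj₁; proj₂)
open import Data.Sum using (inj₁; inj₂)
open import Data.Empty using (⊥-elim)
open import Relation.Binary.PropositionalEquality
open import Relation.Nullary using (¬_)

module _ {A : Set} {_+_ _*_ : Op₂ A} { -_ : Op₁ A} {0# 1# : A} where
  open Algebra.Definitions {A = A} _≡_
  open Algebra.Consequences.Propositional {A = A}

  isCommutativeRingʳ : Associative _+_ → Commutative _+_ → RightIdentity 0# _+_ →
                       RightInverse 0# -_ _+_ → Associative _*_ → Commutative _*_ →
                       RightIdentity 1# _*_ → _*_ DistributesOverʳ _+_ →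
                       IsCommutativeRing _≡_ _+_ _*_ -_ 0# 1#
  isCommutativeRingʳ +-assoc +-comm +-idʳ +-invʳ *-assoc *-comm *-idʳ distribʳ = record
    { isRing = record
      { +-isAbelianGroup = record
        { isGroup = record
          { isMonoid = record
            { isSemigroup = record
              { isMagma = record { isEquivalence = isEquivalence ; ∙-cong = cong₂ _+_ }
              ; assoc = +-assoc }
            ; identity = comm∧idʳ⇒id +-comm +-idʳ }
          ; inverse = comm∧invʳ⇒inv +-comm +-invʳ
          ; ⁻¹-cong = cong -_ }
        ; comm = +-comm }
      ; *-cong = cong₂ _*_
      ; *-assoc = *-assoc
      ; *-identity = comm∧idʳ⇒id *-comm *-idʳ
      ; distrib = comm∧distrʳ⇒distrˡ *-comm distribʳ , distribʳ }
    ; *-comm = *-comm }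

module OrderedFieldProperties (F : RealField) where
  open RealField F

  ℝ-commutativeRing : CommutativeRing 0ℓ 0ℓ
  ℝ-commutativeRing = record
    { isCommutativeRing =
        isCommutativeRingʳ +-assoc +-comm +-idʳ +-invʳ *-assoc *-comm *-idʳ distribʳ }

  open CommutativeRing ℝ-commutativeRing public using (+-identityˡ; *-identityˡ; zeroˡ; zeroʳ)
  open Algebra.Properties.Ring (CommutativeRing.ring ℝ-commutativeRing) public
    using (-1*x≈-x)
  open Algebra.Properties.Group (CommutativeRing.+-group ℝ-commutativeRing) public
    using () renaming (ε⁻¹≈ε to -0≡0)
  open Algebra.Properties.Monoid.Sum (CommutativeRing.+-monoid ℝ-commutativeRing) public
    using (sum)

  0<⇒≢0 : ∀ {x} → 0r < x → x ≢ 0r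
  0<⇒≢0 0<x refl = <-irrefl 0r 0<x

  *-cancelˡ-≢0 : ∀ c x y → c ≢ 0r → c * x ≡ c * y → x ≡ y
  *-cancelˡ-≢0 c x y c≢0 cx≡cy with *-inv c c≢0
  ... | c⁻¹ , cc⁻¹≡1 = begin
    x               ≡⟨ sym (*-identityˡ x) ⟩
    1r * x          ≡⟨ cong (_* x) (trans (sym cc⁻¹≡1) (*-comm c c⁻¹)) ⟩
    c⁻¹ * c * x     ≡⟨ *-assoc c⁻¹ c x ⟩
    c⁻¹ * (c * x)   ≡⟨ cong (c⁻¹ *_) cx≡cy ⟩
    c⁻¹ * (c * y)   ≡⟨ sym (*-assoc c⁻¹ c y) ⟩
    c⁻¹ * c * y     ≡⟨ cong (_* y) (trans (*-comm c⁻¹ c) cc⁻¹≡1) ⟩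
    1r * y          ≡⟨ *-identityˡ y ⟩
    y               ∎
    where open ≡-Reasoning

  0<x∧x*y≡0⇒y≡0 : ∀ {a x} → 0r < a → a * x ≡ 0r → x ≡ 0r
  0<x∧x*y≡0⇒y≡0 {a} {x} 0<a ax≡0 = *-cancelˡ-≢0 a x 0r (0<⇒≢0 0<a) (trans ax≡0 (sym (zeroʳ a)))

  +-nonneg : ∀ {x y} → 0r ≤ x → 0r ≤ y → 0r ≤ x + y
  +-nonneg {y = y} (inj₂ refl) 0≤y = subst (0r ≤_) (sym (+-identityˡ y)) 0≤y
  +-nonneg {x} (inj₁ 0<x) (inj₂ refl) = inj₁ (subst (0r <_) (sym (+-idʳ x)) 0<x)
  +-nonneg {x} {y} (inj₁ 0<x) (inj₁ 0<y) =
    inj₁ (<-trans 0<y (subst (_< x + y) (+-identityˡ y) (+-mono-< y 0<x)))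

  *-nonneg : ∀ {x y} → 0r ≤ x → 0r ≤ y → 0r ≤ x * y
  *-nonneg {y = y} (inj₂ refl) _ = inj₂ (sym (zeroˡ y))
  *-nonneg {x} (inj₁ _) (inj₂ refl) = inj₂ (sym (zeroʳ x))
  *-nonneg (inj₁ 0<x) (inj₁ 0<y) = inj₁ (*-pos 0<x 0<y)

  nonneg∧+≡0⇒ˡ≡0 : ∀ {x y} → 0r ≤ x → 0r ≤ y → x + y ≡ 0r → x ≡ 0r
  nonneg∧+≡0⇒ˡ≡0 (inj₂ 0≡x) _ _ = sym 0≡x
  nonneg∧+≡0⇒ˡ≡0 {x} {y} (inj₁ 0<x) 0≤y x+y≡0 = ⊥-elim (0≰y 0≤y)
    where
      y<0 : y < 0r
      y<0 = subst₂ _<_ (+-identityˡ y) x+y≡0 (+-mono-< y 0<x)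
      0≰y : ¬ (0r ≤ y)
      0≰y (inj₁ 0<y) = <-irrefl 0r (<-trans 0<y y<0)
      0≰y (inj₂ refl) = <-irrefl 0r y<0

  nonneg∧+≡0⇒ʳ≡0 : ∀ {x y} → 0r ≤ x → 0r ≤ y → x + y ≡ 0r → y ≡ 0r
  nonneg∧+≡0⇒ʳ≡0 {x} {y} 0≤x 0≤y x+y≡0 = nonneg∧+≡0⇒ˡ≡0 0≤y 0≤x (trans (+-comm y x) x+y≡0)

  sum-nonneg : ∀ {n} (f : Fin n → R) → (∀ i → 0r ≤ f i) → 0r ≤ sum f
  sum-nonneg {zero} f _ = inj₂ refl
  sum-nonneg {suc n} f 0≤f = +-nonneg (0≤f zero) (sum-nonneg (λ i → f (suc i)) (λ i → 0≤f (suc i)))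

  nonneg∧sum≡0⇒≡0 : ∀ {n} (f : Fin n → R) → (∀ i → 0r ≤ f i) → sum f ≡ 0r → ∀ i → f i ≡ 0r
  nonneg∧sum≡0⇒≡0 {suc _} f 0≤f Σf≡0 zero =
    nonneg∧+≡0⇒ˡ≡0 (0≤f zero) (sum-nonneg _ (λ i → 0≤f (suc i))) Σf≡0
  nonneg∧sum≡0⇒≡0 {suc _} f 0≤f Σf≡0 (suc i) =
    nonneg∧sum≡0⇒≡0 (λ i → f (suc i)) (λ i → 0≤f (suc i))
      (nonneg∧+≡0⇒ʳ≡0 (0≤f zero) (sum-nonneg _ (λ i → 0≤f (suc i))) Σf≡0) i

module AlgebraProperties {F : RealField} (𝒜 : RAlgebra F) where
  open RealField F using (0r; 1r; -_)
    renaming (_+_ to _+ᵣ_; +-comm to +ᵣ-comm; +-idʳ to +ᵣ-idʳ; +-invʳ to +ᵣ-invʳ)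
  open RAlgebra 𝒜
  open ≡-Reasoning

  T-commutativeRing : CommutativeRing 0ℓ 0ℓ
  T-commutativeRing = record
    { isCommutativeRing =
        isCommutativeRingʳ ⊕-assoc ⊕-comm ⊕-idʳ ⊕-invʳ ⊙-assoc ⊙-comm ⊙-idʳ distribʳ }

  open CommutativeRing T-commutativeRing public using () renaming (*-identityˡ to ⊙-idˡ)
  open Algebra.Properties.Ring (CommutativeRing.ring T-commutativeRing)
    using (-‿distribˡ-*; x+x≈x⇒x≈0)
  open Algebra.Properties.Group (CommutativeRing.+-group T-commutativeRing)
    using (inverseˡ-unique)

  ·-zeroˡ : ∀ x → 0r · x ≡ 𝟘
  ·-zeroˡ x = x+x≈x⇒x≈0 (0r · x) (trans (sym (·-distribʳ 0r 0r x)) (cong (_· x) (+ᵣ-idʳ 0r)))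

  ⊖≡-1· : ∀ x → ⊖ x ≡ (- 1r) · x
  ⊖≡-1· x = sym (inverseˡ-unique ((- 1r) · x) x (begin
    (- 1r) · x ⊕ x         ≡⟨ cong ((- 1r) · x ⊕_) (·-id x) ⟨
    (- 1r) · x ⊕ 1r · x    ≡⟨ ·-distribʳ (- 1r) 1r x ⟨
    ((- 1r) +ᵣ 1r) · x     ≡⟨ cong (_· x) (trans (+ᵣ-comm (- 1r) 1r) (+ᵣ-invʳ 1r)) ⟩
    0r · x                 ≡⟨ ·-zeroˡ x ⟩
    𝟘                      ∎))

  infix 4 _⊑_
  _⊑_ : T → T → Set
  E ⊑ D = E ⊙ D ≡ E

  ∨-⊙ : ∀ E G X → (E ∨ G) ⊙ X ≡ E ⊙ X ⊕ G ⊙ X ⊕ ⊖ (E ⊙ G ⊙ X)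
  ∨-⊙ E G X = begin
    (E ⊕ G ⊕ ⊖ (E ⊙ G)) ⊙ X          ≡⟨ distribʳ X (E ⊕ G) (⊖ (E ⊙ G)) ⟩
    (E ⊕ G) ⊙ X ⊕ (⊖ (E ⊙ G)) ⊙ X    ≡⟨ cong₂ _⊕_ (distribʳ X E G) (sym (-‿distribˡ-* (E ⊙ G) X)) ⟩
    E ⊙ X ⊕ G ⊙ X ⊕ ⊖ (E ⊙ G ⊙ X)    ∎

  ∨-least : ∀ {E G D} → E ⊑ D → G ⊑ D → E ∨ G ⊑ D
  ∨-least {E} {G} {D} E⊑D G⊑D = begin
    (E ∨ G) ⊙ D                      ≡⟨ ∨-⊙ E G D ⟩
    E ⊙ D ⊕ G ⊙ D ⊕ ⊖ (E ⊙ G ⊙ D)    ≡⟨ cong₂ (λ a b → a ⊕ ⊖ b) (cong₂ _⊕_ E⊑D G⊑D)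
                                          (trans (⊙-assoc E G D) (cong (E ⊙_) G⊑D)) ⟩
    E ∨ G                            ∎

  ⊑-∨ˡ : ∀ {A E} G → A ⊑ E → A ⊑ E ∨ G
  ⊑-∨ˡ {A} {E} G A⊑E = begin
    A ⊙ (E ∨ G)                       ≡⟨ ⊙-comm A (E ∨ G) ⟩
    (E ∨ G) ⊙ A                       ≡⟨ ∨-⊙ E G A ⟩
    E ⊙ A ⊕ G ⊙ A ⊕ ⊖ (E ⊙ G ⊙ A)     ≡⟨ cong₂ (λ a b → a ⊕ G ⊙ A ⊕ ⊖ b) E⊙A≡A EGA≡GA ⟩
    A ⊕ G ⊙ A ⊕ ⊖ (G ⊙ A)             ≡⟨ ⊕-assoc A (G ⊙ A) (⊖ (G ⊙ A)) ⟩
    A ⊕ (G ⊙ A ⊕ ⊖ (G ⊙ A))           ≡⟨ cong (A ⊕_) (⊕-invʳ (G ⊙ A)) ⟩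
    A ⊕ 𝟘                             ≡⟨ ⊕-idʳ A ⟩
    A                                 ∎
    where
      E⊙A≡A : E ⊙ A ≡ A
      E⊙A≡A = trans (⊙-comm E A) A⊑E
      EGA≡GA : E ⊙ G ⊙ A ≡ G ⊙ A
      EGA≡GA = begin
        E ⊙ G ⊙ A     ≡⟨ cong (_⊙ A) (⊙-comm E G) ⟩
        G ⊙ E ⊙ A     ≡⟨ ⊙-assoc G E A ⟩
        G ⊙ (E ⊙ A)   ≡⟨ cong (G ⊙_) E⊙A≡A ⟩
        G ⊙ A         ∎

  ∨-comm : ∀ E G → E ∨ G ≡ G ∨ E
  ∨-comm E G = cong₂ (λ a b → a ⊕ ⊖ b) (⊕-comm E G) (⊙-comm E G)

  ⊑-∨ʳ : ∀ {A G} E → A ⊑ G → A ⊑ E ∨ G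
  ⊑-∨ʳ {A} {G} E A⊑G = subst (A ⊑_) (∨-comm G E) (⊑-∨ˡ E A⊑G)

  ⋁ : (m : ℕ) → (Fin (suc m) → T) → T
  ⋁ zero    Ds = Ds zero
  ⋁ (suc m) Ds = Ds zero ∨ ⋁ m (λ j → Ds (suc j))

  ⊑-⋁ : ∀ m Ds → (∀ j → IsEvent (Ds j)) → ∀ j → Ds j ⊑ ⋁ m Ds
  ⊑-⋁ zero    Ds event zero    = event zero
  ⊑-⋁ (suc m) Ds event zero    = ⊑-∨ˡ _ (event zero)
  ⊑-⋁ (suc m) Ds event (suc j) = ⊑-∨ʳ (Ds zero) (⊑-⋁ m (λ j → Ds (suc j)) (λ j → event (suc j)) j)

  ⋁-least : ∀ m Ds {D} → (∀ j → Ds j ⊑ D) → ⋁ m Ds ⊑ D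
  ⋁-least zero    Ds Ds⊑D = Ds⊑D zero
  ⋁-least (suc m) Ds Ds⊑D = ∨-least (Ds⊑D zero) (⋁-least m (λ j → Ds (suc j)) (λ j → Ds⊑D (suc j)))

module PlausibleValueProperties
    {F : RealField} {𝒜 : RAlgebra F} {𝒞 : RAlgebra.T 𝒜 → Set}
    {PV : RAlgebra.T 𝒜 → RAlgebra.T 𝒜 → Maybe (RealField.R F)}
    (isPV : IsDTPlausibleValue 𝒜 𝒞 PV) where
  open RealField F hiding (distribʳ)
  open RAlgebra 𝒜
  open OrderedFieldProperties F
  open AlgebraProperties 𝒜
  open IsDTPlausibleValue isPV
  open ≡-Reasoning

  pv-𝟘 : ∀ {D} → 𝒞 D → PV 𝟘 D ≡ just 0r
  pv-𝟘 {D} D∈𝒞 with pv-self D D∈𝒞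
  ... | c , PV[D|D]≡c , _ =
    subst₂ (λ X v → PV X D ≡ just v) (·-zeroˡ D) (zeroˡ c) (pv-scale 0r D D c D∈𝒞 PV[D|D]≡c)

  pv-⊖ : ∀ {X D v} → 𝒞 D → PV X D ≡ just v → PV (⊖ X) D ≡ just (- v)
  pv-⊖ {X} {D} {v} D∈𝒞 PV[X|D]≡v =
    subst₂ (λ Y w → PV Y D ≡ just w) (sym (⊖≡-1· X)) (-1*x≈-x v)
      (pv-scale (- 1r) X D v D∈𝒞 PV[X|D]≡v)

  pv-unique : ∀ {X D v w} → PV X D ≡ just v → PV X D ≡ just w → v ≡ w
  pv-unique PV[X|D]≡v PV[X|D]≡w = just-injective (trans (sym PV[X|D]≡v) PV[X|D]≡w)

  pv-⊑ : ∀ {X C D v} → 𝒞 C → 𝒞 D → C ⊑ D → PV X C ≡ just v →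
         Σ R (λ w → (0r ≤ w) × (PV C D ≡ just w) × (PV (X ⊙ C) D ≡ just (v * w)))
  pv-⊑ {X} {C} {D} {v} C∈𝒞 D∈𝒞 C⊑D PV[X|C]≡v
    with pv-event C D (proj₁ (𝒞⊆E₀ C C∈𝒞)) D∈𝒞
       | pv-mult X C D v (subst 𝒞 (sym C⊑D) C∈𝒞) D∈𝒞
           (subst (λ Z → PV X Z ≡ just v) (sym C⊑D) PV[X|C]≡v)
  ... | w , PV[C|D]≡w , 0≤w | w′ , PV[C|D]≡w′ , PV[XC|D]≡vw′ =
    w , 0≤w , PV[C|D]≡w ,
    subst (λ u → PV (X ⊙ C) D ≡ just (v * u)) (pv-unique PV[C|D]≡w′ PV[C|D]≡w) PV[XC|D]≡vw′

  pv-𝟙 : ∀ {C} → 𝒞 C → PV 𝟙 C ≡ just 1r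
  pv-𝟙 {C} C∈𝒞 with pv-event 𝟙 C (⊙-idʳ 𝟙) C∈𝒞 | pv-self C C∈𝒞
  ... | u , PV[𝟙|C]≡u , _ | c , PV[C|C]≡c , 0<c
    with pv-⊑ C∈𝒞 C∈𝒞 (proj₁ (𝒞⊆E₀ C C∈𝒞)) PV[𝟙|C]≡u
  ... | w , _ , PV[C|C]≡w , PV[𝟙⊙C|C]≡uw = trans PV[𝟙|C]≡u (cong just u≡1)
    where
      c≡w : c ≡ w
      c≡w = pv-unique PV[C|C]≡c PV[C|C]≡w
      uw≡c : u * w ≡ c
      uw≡c = pv-unique (subst (λ Z → PV Z C ≡ just (u * w)) (⊙-idˡ C) PV[𝟙⊙C|C]≡uw) PV[C|C]≡c
      u≡1 : u ≡ 1r
      u≡1 = *-cancelˡ-≢0 c u 1r (0<⇒≢0 0<c) (begin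
        c * u    ≡⟨ *-comm c u ⟩
        u * c    ≡⟨ cong (u *_) c≡w ⟩
        u * w    ≡⟨ uw≡c ⟩
        c        ≡⟨ *-idʳ c ⟨
        c * 1r   ∎)

  pv-ι : ∀ {D} s → 𝒞 D → PV (ι s) D ≡ just s
  pv-ι {D} s D∈𝒞 = subst (λ v → PV (ι s) D ≡ just v) (*-idʳ s) (pv-scale s 𝟙 D 1r D∈𝒞 (pv-𝟙 D∈𝒞))

  pv-∑ : ∀ {D n} → 𝒞 D → (f : Fin n → T) (v : Fin n → R) →
         (∀ i → PV (f i) D ≡ just (v i)) → PV (∑ n f) D ≡ just (sum v)
  pv-∑ {n = zero}  D∈𝒞 f v PV[f|D]≡v = pv-𝟘 D∈𝒞
  pv-∑ {n = suc n} D∈𝒞 f v PV[f|D]≡v =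
    pv-add _ _ _ _ _ D∈𝒞 (PV[f|D]≡v zero)
      (pv-∑ D∈𝒞 (λ i → f (suc i)) (λ i → v (suc i)) (λ i → PV[f|D]≡v (suc i)))

  𝒞-⋁ : ∀ m Ds → (∀ j → 𝒞 (Ds j)) → 𝒞 (⋁ m Ds)
  𝒞-⋁ zero    Ds Ds∈𝒞 = Ds∈𝒞 zero
  𝒞-⋁ (suc m) Ds Ds∈𝒞 = 𝒞-∨ _ _ (Ds∈𝒞 zero) (𝒞-⋁ m (λ j → Ds (suc j)) (λ j → Ds∈𝒞 (suc j)))

  pv-∨-null : ∀ {E G D} → 𝒞 E → 𝒞 G → 𝒞 D → G ⊑ D →
              PV E D ≡ just 0r → PV G D ≡ just 0r → PV (E ∨ G) D ≡ just 0r
  pv-∨-null {E} {G} {D} E∈𝒞 G∈𝒞 D∈𝒞 G⊑D PV[E|D]≡0 PV[G|D]≡0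
    with pv-event E G (proj₁ (𝒞⊆E₀ E E∈𝒞)) G∈𝒞
  ... | e , PV[E|G]≡e , _ with pv-⊑ G∈𝒞 D∈𝒞 G⊑D PV[E|G]≡e
  ... | w , _ , PV[G|D]≡w , PV[EG|D]≡ew =
    subst (λ v → PV (E ∨ G) D ≡ just v) 0+0-0≡0
      (pv-add _ _ D _ _ D∈𝒞 (pv-add E G D _ _ D∈𝒞 PV[E|D]≡0 PV[G|D]≡0) (pv-⊖ D∈𝒞 PV[EG|D]≡0))
    where
      PV[EG|D]≡0 : PV (E ⊙ G) D ≡ just 0r
      PV[EG|D]≡0 = trans PV[EG|D]≡ew
        (cong just (trans (cong (e *_) (pv-unique PV[G|D]≡w PV[G|D]≡0)) (zeroʳ e)))
      0+0-0≡0 : 0r + 0r + - 0r ≡ 0r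
      0+0-0≡0 = trans (cong₂ _+_ (+-idʳ 0r) -0≡0) (+-idʳ 0r)

  pv-⋁-null : ∀ m Ds {D} → (∀ j → 𝒞 (Ds j)) → 𝒞 D → (∀ j → Ds j ⊑ D) →
              (∀ j → PV (Ds j) D ≡ just 0r) → PV (⋁ m Ds) D ≡ just 0r
  pv-⋁-null zero    Ds Ds∈𝒞 D∈𝒞 Ds⊑D null = null zero
  pv-⋁-null (suc m) Ds Ds∈𝒞 D∈𝒞 Ds⊑D null =
    pv-∨-null (Ds∈𝒞 zero) (𝒞-⋁ m Ds′ Ds′∈𝒞) D∈𝒞 (⋁-least m Ds′ (λ j → Ds⊑D (suc j)))
      (null zero) (pv-⋁-null m Ds′ Ds′∈𝒞 D∈𝒞 (λ j → Ds⊑D (suc j)) (λ j → null (suc j)))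
    where
      Ds′ = λ j → Ds (suc j)
      Ds′∈𝒞 = λ j → Ds∈𝒞 (suc j)

  ⋁-not-null : ∀ m Ds → (∀ j → 𝒞 (Ds j)) → ¬ (∀ j → PV (Ds j) (⋁ m Ds) ≡ just 0r)
  ⋁-not-null m Ds Ds∈𝒞 null = 0<⇒≢0 0<c (pv-unique PV[D|D]≡c PV[D|D]≡0)
    where
      D = ⋁ m Ds
      D∈𝒞 = 𝒞-⋁ m Ds Ds∈𝒞
      PV[D|D]≡0 = pv-⋁-null m Ds Ds∈𝒞 D∈𝒞 (⊑-⋁ m Ds (λ j → proj₁ (𝒞⊆E₀ (Ds j) (Ds∈𝒞 j)))) null
      c = proj₁ (pv-self D D∈𝒞)
      PV[D|D]≡c = proj₁ (proj₂ (pv-self D D∈𝒞))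
      0<c = proj₂ (proj₂ (pv-self D D∈𝒞))

  events+bets≢𝟘 : ∀ {n m} (q : Fin n → R) → (∀ i → 0r ≤ q i) →
                  (Cs : Fin n → T) → (∀ i → IsEvent (Cs i)) →
                  (Ys Ds : Fin (suc m) → T) → (∀ j → IsEvent (Ds j)) →
                  (a : Fin (suc m) → R) → (∀ j → 0r < a j) → (∀ j → PV (Ys j) (Ds j) ≡ just (a j)) →
                  ∑ n (λ i → q i · Cs i) ⊕ ∑ (suc m) (λ j → Ys j ⊙ Ds j) ≢ 𝟘
  events+bets≢𝟘 {n} {m} q 0≤q Cs Cs-event Ys Ds Ds-event a 0<a PV[Ys|Ds]≡a Z≡𝟘 =
    ⋁-not-null m Ds Ds∈𝒞 (λ j → trans (PV[Ds|D]≡w j) (cong just (w≡0 j)))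
    where
      Ds∈𝒞 : ∀ j → 𝒞 (Ds j)
      Ds∈𝒞 j = dom⊆𝒞 (Ys j) (Ds j) (a j) (PV[Ys|Ds]≡a j)
      D = ⋁ m Ds
      D∈𝒞 = 𝒞-⋁ m Ds Ds∈𝒞
      event = λ i → pv-event (Cs i) D (Cs-event i) D∈𝒞
      c : Fin n → R
      c i = proj₁ (event i)
      PV[qC|D]≡qc : ∀ i → PV (q i · Cs i) D ≡ just (q i * c i)
      PV[qC|D]≡qc i = pv-scale (q i) (Cs i) D (c i) D∈𝒞 (proj₁ (proj₂ (event i)))
      0≤qc : ∀ i → 0r ≤ q i * c i
      0≤qc i = *-nonneg (0≤q i) (proj₂ (proj₂ (event i)))
      bet = λ j → pv-⊑ (Ds∈𝒞 j) D∈𝒞 (⊑-⋁ m Ds Ds-event j) (PV[Ys|Ds]≡a j)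
      w : Fin (suc m) → R
      w j = proj₁ (bet j)
      PV[Ds|D]≡w : ∀ j → PV (Ds j) D ≡ just (w j)
      PV[Ds|D]≡w j = proj₁ (proj₂ (proj₂ (bet j)))
      0≤aw : ∀ j → 0r ≤ a j * w j
      0≤aw j = *-nonneg (inj₁ (0<a j)) (proj₁ (proj₂ (bet j)))
      gain≡0 : sum (λ i → q i * c i) + sum (λ j → a j * w j) ≡ 0r
      gain≡0 = pv-unique
        (pv-add _ _ D _ _ D∈𝒞 (pv-∑ D∈𝒞 _ _ PV[qC|D]≡qc)
                              (pv-∑ D∈𝒞 _ _ (λ j → proj₂ (proj₂ (proj₂ (bet j))))))
        (subst (λ Z → PV Z D ≡ just 0r) (sym Z≡𝟘) (pv-𝟘 D∈𝒞))
      w≡0 : ∀ j → w j ≡ 0r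
      w≡0 j = 0<x∧x*y≡0⇒y≡0 (0<a j)
        (nonneg∧sum≡0⇒≡0 _ 0≤aw (nonneg∧+≡0⇒ʳ≡0 (sum-nonneg _ 0≤qc) (sum-nonneg _ 0≤aw) gain≡0) j)

module _ {F : RealField} (𝒜 : RAlgebra F)
         (PV : RAlgebra.T 𝒜 → RAlgebra.T 𝒜 → Maybe (RealField.R F)) where
  open RealField F

  asExtended-bet : ∀ {X D r s} →
                   Σ (ExtR F) (λ v → (asExtended 𝒜 PV X D ≡ just v) × PosTerm F r v s) →
                   Σ R (λ v → (PV X D ≡ just v) × (0r < r * (v + s)))
  asExtended-bet {X} {D} bet with PV X D
  asExtended-bet (_ , refl , 0<r[v+s]) | just v = v , refl , 0<r[v+s]

mainTheorem16 : (F : RealField) (A : RAlgebra F) (𝒞 : RAlgebra.T A → Set)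
                (PV : RAlgebra.T A → RAlgebra.T A → Maybe (RealField.R F)) →
                IsDTPlausibleValue A 𝒞 PV → Coherent A (asExtended A PV)
mainTheorem16 F 𝒜 𝒞 PV isPV n m q 0≤q r s Cs Cs-event Ds Ds-event Xs bets =
  events+bets≢𝟘 q 0≤q Cs Cs-event (λ j → r j · (Xs j ⊕ ι (s j))) Ds Ds-event a 0<a PV[Y|Ds]≡a
  where
    open RealField F hiding (distribʳ)
    open RAlgebra 𝒜
    open IsDTPlausibleValue isPV
    open PlausibleValueProperties isPV
    v = λ j → proj₁ (asExtended-bet 𝒜 PV (bets j))
    PV[X|Ds]≡v = λ j → proj₁ (proj₂ (asExtended-bet 𝒜 PV (bets j)))
    a = λ j → r j * (v j + s j)
    0<a = λ j → proj₂ (proj₂ (asExtended-bet 𝒜 PV (bets j)))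
    PV[Y|Ds]≡a : ∀ j → PV (r j · (Xs j ⊕ ι (s j))) (Ds j) ≡ just (a j)
    PV[Y|Ds]≡a j =
      pv-scale (r j) _ (Ds j) _ D∈𝒞
        (pv-add (Xs j) (ι (s j)) (Ds j) _ _ D∈𝒞 (PV[X|Ds]≡v j) (pv-ι (s j) D∈𝒞))
      where D∈𝒞 = dom⊆𝒞 (Xs j) (Ds j) (v j) (PV[X|Ds]≡v j)
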